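{- There exist infinitely many squarefree integers $D>1$ with $D\equiv 1\pmod 4$ for which the ring of integers $\mathcal{O}_K$ of the real quadratic field $K=\mathbb{Q}(\sqrt{D})$ contains a nonzero ideal $I$ such that $\Lambda_K(I)$ is WR.
   Context: For a real quadratic field $K=\mathbb{Q}(\sqrt{D})$ with real embeddings $\sigma_1:\sqrt{D}\mapsto\sqrt{D}$ and $\sigma_2:\sqrt{D}\mapsto-\sqrt{D}$, define $\sigma:K\to\mathbb{R}^2$, $\sigma(x)=(\sigma_1(x),\sigma_2(x))$; $\Lambda_K(I)=\sigma(I)$. A full-rank lattice $\Lambda\subset\mathbb{R}^2$ is well-rounded (WR) if its set of minimal vectors $S(\Lambda)=\{x\in\Lambda:\|x\|^2=\min_{y\in\Lambda\setminus\{0\}}\|y\|^2\}$ (Euclidean norm) spans $\mathbb{R}^2$. -}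

module Defs where

open import Data.Nat as ℕ using (ℕ; _<_; _%_; _/_)
open import Data.Nat.Divisibility using (_∣_)
open import Data.Integer as ℤ using (ℤ; _+_; _*_; _-_; _≤_; +_; -_)
open import Data.Product using (_×_; _,_; ∃; ∃-syntax; Σ-syntax)
open import Relation.Binary.PropositionalEquality using (_≡_; _≢_)
open import Relation.Nullary using (¬_)

SquareFree : ℕ → Set
SquareFree D = ∀ (n : ℕ) → (n ℕ.* n) ∣ D → n ≡ 1

-- For D ≡ 1 (mod 4), O_K = ℤ[ω] with ω = (1 + √D)/2 and ω² = ω + (D-1)/4.
-- An element of O_K is represented by its coordinates (a , b), meaning a + b ω.
OK : Set
OK = ℤ × ℤ

-- (D - 1)/4 as an integer (for D % 4 ≡ 1, ℕ-division D / 4 equals (D-1)/4).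
kD : ℕ → ℤ
kD D = + (D / 4)

zeroOK : OK
zeroOK = (+ 0 , + 0)

_⊕_ : OK → OK → OK
(a , b) ⊕ (c , d) = (a + c , b + d)

-- (a + bω)(c + dω) = (ac + bd k) + (ad + bc + bd) ω,   k = (D-1)/4
mulOK : ℕ → OK → OK → OK
mulOK D (a , b) (c , d) = (a * c + b * d * kD D , a * d + b * c + b * d)

-- Coordinates of 2x in the basis (1, √D): x = a + bω = ((2a + b) + b √D)/2.
-- So σ(x) = ((u + v√D)/2 , (u - v√D)/2) with (u , v) = twice x.
twice : OK → ℤ × ℤ
twice (a , b) = ((+ 2) * a + b , b)

-- 2‖σ(x)‖² = u² + D v²   (exact: ‖σ(x)‖² = (u² + D v²)/2).
normSq2 : ℕ → OK → ℤ
normSq2 D x with twice x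
... | (u , v) = u * u + (+ D) * v * v

-- det(σ(x), σ(y)) = σ₁(x)σ₂(y) − σ₁(y)σ₂(x) = (√D / 2)(v u' − u v');
-- since √D ≠ 0, it is nonzero iff detScaled x y ≠ 0.
detScaled : OK → OK → ℤ
detScaled x y with twice x | twice y
... | (u , v) | (u' , v') = v * u' - u * v'

record IsIdeal (D : ℕ) (I : OK → Set) : Set where
  field
    zero-mem : I zeroOK
    add-mem  : ∀ {x y} → I x → I y → I (x ⊕ y)
    mul-mem  : ∀ (r : OK) {x} → I x → I (mulOK D r x)

NonzeroIdeal : ℕ → (OK → Set) → Set
NonzeroIdeal D I = IsIdeal D I × (∃[ x ] (I x × x ≢ zeroOK))

MinimalVec : ℕ → (OK → Set) → OK → Set
MinimalVec D I x =
  I x × x ≢ zeroOK × (∀ y → I y → y ≢ zeroOK → normSq2 D x ≤ normSq2 D y)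

-- Λ_K(I) is well-rounded: its minimal vectors span ℝ², i.e. there are two
-- minimal vectors with nonzero determinant.
WR : ℕ → (OK → Set) → Set
WR D I = ∃[ x ] ∃[ y ] (MinimalVec D I x × MinimalVec D I y × detScaled x y ≢ + 0)

module Submission where

open import Defs
open import Data.Nat using (ℕ; _<_; _%_)
open import Data.Product using (_×_; ∃-syntax)
open import Relation.Binary.PropositionalEquality using (_≡_)

open import Data.Product using (_,_; proj₂)
open import Relation.Binary.PropositionalEquality using (_≢_)

-- Take D = n (n + 4) with n = 2t + 1 odd, so D ≡ 1 (mod 4), and let I = {x ∈ O_K : n ∣ Tr x}.
-- For x ∈ I write Tr x = j n; then 2‖σ(x)‖² = (j n)² + D b², where x = a + bω.  If j = 0 then
-- b = -2a, and if b = 0 then j is even; so for x ≠ 0 either |j|, |b| ≥ 1, or one of them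
-- vanishes and the other is at least 2.  Since n² ≤ 3D ≤ 9n², this forces 2‖σ(x)‖² ≥ n² + D,
-- which is attained by the two independent vectors σ((n ± √D)/2): the lattice is well-rounded.
--
-- It remains to find infinitely many t with 2t + 1 and 2t + 5 squarefree (they are coprime,
-- so then D is squarefree).  Among t = N + i, i < L = 4(S + 1), an odd square (2s+3)² divides
-- 2t + 1 (resp. 2t + 5) for at most L/(2s+3)² + 1 values of i, and moduli with s ≥ S are
-- irrelevant below (2S + 3)².  As 1/(2s+3)² < 1/(4(s+1)) − 1/(4(s+2)), the sum over s < S
-- telescopes to at most L/4 + S per family, so at most L − 2 values of i are sieved out.

module LatticeMinimum where
  open import Data.Nat
  open import Data.Nat.Properties
  open import Data.Nat.Tactic.RingSolver using (solve-∀)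
  open import Relation.Binary.PropositionalEquality

  n²+D≤norm : ∀ {n D J V} → n * n ≤ 3 * D → D ≤ 3 * (n * n) →
              (J ≡ 0 → 2 ≤ V) → (V ≡ 0 → 2 ≤ J) →
              n * n + D ≤ (J * n) * (J * n) + D * (V * V)
  n²+D≤norm {n} {D} {zero} {V} n²≤3D _ 2≤V _ = begin
    n * n + D   ≤⟨ +-monoˡ-≤ D n²≤3D ⟩
    3 * D + D   ≡⟨ +-comm (3 * D) D ⟩
    4 * D       ≡⟨ *-comm 4 D ⟩
    D * 4       ≤⟨ *-monoʳ-≤ D (*-mono-≤ (2≤V refl) (2≤V refl)) ⟩
    D * (V * V) ∎
    where open ≤-Reasoning
  n²+D≤norm {n} {D} {suc J} {zero} _ D≤3n² _ 2≤J = begin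
    n * n + D                                ≤⟨ +-monoʳ-≤ (n * n) D≤3n² ⟩
    n * n + 3 * (n * n)                      ≡⟨ four-squares n ⟩
    (2 * n) * (2 * n)                        ≤⟨ *-mono-≤ 2n≤Jn 2n≤Jn ⟩
    (suc J * n) * (suc J * n)                ≡⟨ +-identityʳ _ ⟨
    (suc J * n) * (suc J * n) + 0            ≡⟨ cong ((suc J * n) * (suc J * n) +_) (*-zeroʳ D) ⟨
    (suc J * n) * (suc J * n) + D * (0 * 0)  ∎
    where
    open ≤-Reasoning
    2n≤Jn : 2 * n ≤ suc J * n
    2n≤Jn = *-monoˡ-≤ n (2≤J refl)
    four-squares : ∀ n → n * n + 3 * (n * n) ≡ (2 * n) * (2 * n)
    four-squares = solve-∀
  n²+D≤norm {n} {D} {suc J} {suc V} _ _ _ _ =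
    +-mono-≤ (*-mono-≤ (m≤n*m n (suc J)) (m≤n*m n (suc J))) (m≤m*n D (suc V * suc V))

module TraceIdeal where
  open import Data.Nat as ℕ using (ℕ; suc; zero; _%_; _/_)
  import Data.Nat.Divisibility as ℕ
  import Data.Nat.Properties as ℕ
  open import Data.Nat.DivMod using (m≡m%n+[m/n]*n)
  open import Data.Integer using (ℤ; +_; -_; _+_; _-_; _*_; ∣_∣; _≤_; +≤+; +[1+_]; -[1+_])
  open import Data.Integer.Properties
    using (+-identityˡ; +-identityʳ; *-assoc; *-identityˡ; *-cancelˡ-≡; neg-involutive;
           pos-*; abs-*; ∣i∣≡0⇒i≡0)
  open import Data.Integer.Divisibility.Signed
    using (_∣_; divides; ∣ᵤ⇒∣; ∣-refl; ∣m∣n⇒∣m+n; ∣m∣n⇒∣m-n; ∣n⇒∣m*n; ∣m⇒∣m*n)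
  open import Data.Integer.Tactic.RingSolver using (solve-∀)
  open import Data.Empty using (⊥-elim)
  open import Relation.Binary.PropositionalEquality
  open LatticeMinimum using (n²+D≤norm)

  trace : OK → ℤ
  trace (a , b) = + 2 * a + b

  trace-⊕ : ∀ x y → trace (x ⊕ y) ≡ trace x + trace y
  trace-⊕ (a , b) (c , d) = rearrange a b c d
    where
    rearrange : ∀ a b c d → + 2 * (a + c) + (b + d) ≡ (+ 2 * a + b) + (+ 2 * c + d)
    rearrange = solve-∀

  trace-mulOK : ∀ D r x → + 2 * trace (mulOK D r x) ≡
                trace r * trace x + (+ 4 * kD D + + 1) * proj₂ r * proj₂ x
  trace-mulOK D (c , d) (a , b) = expand (kD D) a b c d
    where
    expand : ∀ k a b c d → + 2 * (+ 2 * (c * a + d * b * k) + (c * b + d * a + d * b)) ≡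
             (+ 2 * c + d) * (+ 2 * a + b) + (+ 4 * k + + 1) * d * b
    expand = solve-∀

  4kD+1≡D : ∀ {D} → D % 4 ≡ 1 → + 4 * kD D + + 1 ≡ + D
  4kD+1≡D {D} D%4≡1 = begin
    + 4 * + (D / 4) + + 1       ≡⟨ cong (_+ + 1) (pos-* 4 (D / 4)) ⟨
    + (4 ℕ.* (D / 4) ℕ.+ 1)     ≡⟨ cong +_ (ℕ.+-comm (4 ℕ.* (D / 4)) 1) ⟩
    + (1 ℕ.+ 4 ℕ.* (D / 4))     ≡⟨ cong (λ r → + (r ℕ.+ 4 ℕ.* (D / 4))) D%4≡1 ⟨
    + (D % 4 ℕ.+ 4 ℕ.* (D / 4)) ≡⟨ cong (λ q → + (D % 4 ℕ.+ q)) (ℕ.*-comm 4 (D / 4)) ⟩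
    + (D % 4 ℕ.+ D / 4 ℕ.* 4)   ≡⟨ cong +_ (m≡m%n+[m/n]*n D 4) ⟨
    + D                         ∎
    where open ≡-Reasoning

  i*i≡+∣i∣*∣i∣ : ∀ i → i * i ≡ + (∣ i ∣ ℕ.* ∣ i ∣)
  i*i≡+∣i∣*∣i∣ (+ k)    = sym (pos-* k k)
  i*i≡+∣i∣*∣i∣ -[1+ k ] = refl

  normSq2≡abs : ∀ D x →
                normSq2 D x ≡ + (∣ trace x ∣ ℕ.* ∣ trace x ∣ ℕ.+ D ℕ.* (∣ proj₂ x ∣ ℕ.* ∣ proj₂ x ∣))
  normSq2≡abs D (a , b) = cong₂ _+_ (i*i≡+∣i∣*∣i∣ (trace (a , b))) (begin
    + D * b * b                 ≡⟨ *-assoc (+ D) b b ⟩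
    + D * (b * b)               ≡⟨ cong (+ D *_) (i*i≡+∣i∣*∣i∣ b) ⟩
    + D * + (∣ b ∣ ℕ.* ∣ b ∣)   ≡⟨ pos-* D _ ⟨
    + (D ℕ.* (∣ b ∣ ℕ.* ∣ b ∣)) ∎)
    where open ≡-Reasoning

  2≤∣2*w∣ : ∀ w → w ≢ + 0 → 2 ℕ.≤ ∣ + 2 * w ∣
  2≤∣2*w∣ (+ zero) w≢0 = ⊥-elim (w≢0 refl)
  2≤∣2*w∣ +[1+ k ] _   = ℕ.*-monoʳ-≤ 2 (ℕ.s≤s ℕ.z≤n)
  2≤∣2*w∣ -[1+ k ] _   = ℕ.*-monoʳ-≤ 2 (ℕ.s≤s ℕ.z≤n)

  trace≡0⇒2≤∣b∣ : ∀ {a b} → (a , b) ≢ zeroOK → trace (a , b) ≡ + 0 → 2 ℕ.≤ ∣ b ∣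
  trace≡0⇒2≤∣b∣ {a} {b} x≢0 tr≡0 = subst (λ b → 2 ℕ.≤ ∣ b ∣) (sym b≡2*-a) (2≤∣2*w∣ (- a) -a≢0)
    where
    b≡2*-a : b ≡ + 2 * (- a)
    b≡2*-a = trans (shift a b) (trans (cong (_+ + 2 * (- a)) tr≡0) (+-identityˡ _))
      where
      shift : ∀ a b → b ≡ (+ 2 * a + b) + + 2 * (- a)
      shift = solve-∀
    -a≢0 : - a ≢ + 0
    -a≢0 -a≡0 = x≢0 (cong₂ _,_ (trans (sym (neg-involutive a)) (cong -_ -a≡0))
                               (trans b≡2*-a (cong (+ 2 *_) -a≡0)))

  -- For squarefree D and n ∣ D this is the ideal (n, √D).
  TraceDivisibleBy : ℤ → OK → Set
  TraceDivisibleBy n x = n ∣ trace x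

  module OddModulus (t : ℕ) where

    n : ℕ
    n = 2 ℕ.* t ℕ.+ 1

    +n≡2t+1 : + n ≡ + 2 * + t + + 1
    +n≡2t+1 = cong (_+ + 1) (pos-* 2 t)

    I : OK → Set
    I = TraceDivisibleBy (+ n)

    n∣2i⇒n∣i : ∀ {i} → + n ∣ + 2 * i → + n ∣ i
    n∣2i⇒n∣i {i} n∣2i =
      subst (+ n ∣_) (sym split) (∣m∣n⇒∣m-n (∣n⇒∣m*n (+ 1 + + t) n∣2i) (∣m⇒∣m*n i ∣-refl))
      where
      split : i ≡ (+ 1 + + t) * (+ 2 * i) - + n * i
      split = trans (identity (+ t) i) (cong (λ m → (+ 1 + + t) * (+ 2 * i) - m * i) (sym +n≡2t+1))
        where
        identity : ∀ t i → i ≡ (+ 1 + t) * (+ 2 * i) - (+ 2 * t + + 1) * i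
        identity = solve-∀

    isIdeal : ∀ {D} → D % 4 ≡ 1 → n ℕ.∣ D → IsIdeal D I
    isIdeal {D} D%4≡1 n∣D = record
      { zero-mem = divides (+ 0) refl
      ; add-mem  = λ {x} {y} n∣x n∣y → subst (+ n ∣_) (sym (trace-⊕ x y)) (∣m∣n⇒∣m+n n∣x n∣y)
      ; mul-mem  = mul-mem
      }
      where
      n∣4kD+1 : + n ∣ + 4 * kD D + + 1
      n∣4kD+1 = subst (+ n ∣_) (sym (4kD+1≡D D%4≡1)) (∣ᵤ⇒∣ n∣D)
      mul-mem : ∀ r {x} → I x → I (mulOK D r x)
      mul-mem r {x} n∣x = n∣2i⇒n∣i (subst (+ n ∣_) (sym (trace-mulOK D r x))
        (∣m∣n⇒∣m+n (∣n⇒∣m*n (trace r) n∣x) (∣m⇒∣m*n (proj₂ x) (∣m⇒∣m*n (proj₂ r) n∣4kD+1))))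

    b≡0⇒2≤∣j∣ : ∀ {a j} → (a , + 0) ≢ zeroOK → trace (a , + 0) ≡ j * + n → 2 ℕ.≤ ∣ j ∣
    b≡0⇒2≤∣j∣ {a} {j} x≢0 tr≡jn = subst (λ j → 2 ℕ.≤ ∣ j ∣) 2w≡j (2≤∣2*w∣ w w≢0)
      where
      w : ℤ
      w = a - j * + t
      2w≡j : + 2 * w ≡ j
      2w≡j = begin
        + 2 * w                  ≡⟨ expand a j (+ t) ⟩
        (+ 2 * a + + 0) + j - jn ≡⟨ cong (λ u → u + j - jn) tr≡jn ⟩
        j * + n + j - jn         ≡⟨ cong (λ m → j * m + j - jn) +n≡2t+1 ⟩
        jn + j - jn              ≡⟨ cancel j (+ 2 * + t + + 1) ⟩
        j                        ∎
        where
        open ≡-Reasoning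
        jn : ℤ
        jn = j * (+ 2 * + t + + 1)
        expand : ∀ a j t → + 2 * (a - j * t) ≡ (+ 2 * a + + 0) + j - j * (+ 2 * t + + 1)
        expand = solve-∀
        cancel : ∀ j m → j * m + j - j * m ≡ j
        cancel = solve-∀
      w≢0 : w ≢ + 0
      w≢0 w≡0 = x≢0 (cong (_, + 0) a≡0)
        where
        j≡0 : j ≡ + 0
        j≡0 = trans (sym 2w≡j) (cong (+ 2 *_) w≡0)
        a≡0 : a ≡ + 0
        a≡0 = *-cancelˡ-≡ (+ 2) a (+ 0) (trans (sym (+-identityʳ _)) (trans tr≡jn (cong (_* + n) j≡0)))

    module _ {D : ℕ} (n²≤3D : n ℕ.* n ℕ.≤ 3 ℕ.* D) (D≤3n² : D ℕ.≤ 3 ℕ.* (n ℕ.* n)) where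

      n²+D≤normSq2 : ∀ x → I x → x ≢ zeroOK → + (n ℕ.* n ℕ.+ D) ≤ normSq2 D x
      n²+D≤normSq2 (a , b) (divides j tr≡jn) x≢0 =
        subst (+ (n ℕ.* n ℕ.+ D) ≤_) (sym (normSq2≡abs D (a , b)))
          (+≤+ (subst (λ u → n ℕ.* n ℕ.+ D ℕ.≤ u ℕ.* u ℕ.+ D ℕ.* (∣ b ∣ ℕ.* ∣ b ∣)) (sym ∣tr∣≡∣j∣n)
            (n²+D≤norm n²≤3D D≤3n² ∣j∣≡0⇒ ∣b∣≡0⇒)))
        where
        ∣tr∣≡∣j∣n : ∣ trace (a , b) ∣ ≡ ∣ j ∣ ℕ.* n
        ∣tr∣≡∣j∣n = trans (cong ∣_∣ tr≡jn) (abs-* j (+ n))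
        ∣j∣≡0⇒ : ∣ j ∣ ≡ 0 → 2 ℕ.≤ ∣ b ∣
        ∣j∣≡0⇒ ∣j∣≡0 = trace≡0⇒2≤∣b∣ x≢0 (trans tr≡jn (cong (_* + n) (∣i∣≡0⇒i≡0 {j} ∣j∣≡0)))
        ∣b∣≡0⇒ : ∣ b ∣ ≡ 0 → 2 ℕ.≤ ∣ j ∣
        ∣b∣≡0⇒ ∣b∣≡0 with refl ← ∣i∣≡0⇒i≡0 {b} ∣b∣≡0 = b≡0⇒2≤∣j∣ {a} {j} x≢0 tr≡jn

      minimalVec : ∀ x → trace x ≡ + n → ∣ proj₂ x ∣ ≡ 1 → x ≢ zeroOK → MinimalVec D I x
      minimalVec x tr≡n ∣b∣≡1 x≢0 =
        n∣tr , x≢0 , λ y Iy y≢0 → subst (_≤ normSq2 D y) (sym norm≡) (n²+D≤normSq2 y Iy y≢0)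
        where
        n∣tr : I x
        n∣tr = divides (+ 1) (trans tr≡n (sym (*-identityˡ (+ n))))
        norm≡ : normSq2 D x ≡ + (n ℕ.* n ℕ.+ D)
        norm≡ = trans (normSq2≡abs D x)
          (trans (cong₂ (λ u v → + (u ℕ.* u ℕ.+ D ℕ.* (v ℕ.* v))) (cong ∣_∣ tr≡n) ∣b∣≡1)
                 (cong (λ d → + (n ℕ.* n ℕ.+ d)) (ℕ.*-identityʳ D)))

      -- x₁ = (n + √D)/2 and x₂ = (n − √D)/2.
      wellRounded : WR D I
      wellRounded =
        x₁ , x₂ , minimalVec x₁ (sym +n≡2t+1) refl (λ ()) , minimalVec x₂ tr₂≡n refl (λ ()) , det≢0
        where
        x₁ x₂ : OK
        x₁ = (+ t , + 1)
        x₂ = (+ suc t , - + 1)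
        tr₂≡n : trace x₂ ≡ + n
        tr₂≡n = trans (shift (+ t)) (sym +n≡2t+1)
          where
          shift : ∀ t → + 2 * (+ 1 + t) + - + 1 ≡ + 2 * t + + 1
          shift = solve-∀
        det≡2n : detScaled x₁ x₂ ≡ + (n ℕ.+ n)
        det≡2n = trans (swap (trace x₁) (trace x₂)) (cong₂ _+_ tr₂≡n (sym +n≡2t+1))
          where
          swap : ∀ u u′ → + 1 * u′ - u * - + 1 ≡ u′ + u
          swap = solve-∀
        det≢0 : detScaled x₁ x₂ ≢ + 0
        det≢0 det≡0 = ℕ.m+1+n≢0 (2 ℕ.* t) (ℕ.m+n≡0⇒m≡0 n (cong ∣_∣ (trans (sym det≡2n) det≡0)))

open import Data.Nat
open import Data.Nat.Properties
open import Data.Nat.Divisibility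
open import Data.Nat.DivMod using (m*n/n≡m; m/n*n≤m; /-monoˡ-≤; [m+kn]%n≡m%n)
open import Data.Nat.GCD using (gcd; gcd[m,n]∣m; gcd[m,n]∣n)
open import Data.Nat.Coprimality using (Coprime; coprime-divisor; coprime-factors; gcd≡1⇒coprime)
  renaming (sym to coprime-sym)
open import Data.Nat.Tactic.RingSolver using (solve-∀)
open import Data.Sum using (_⊎_; inj₁; inj₂; [_,_])
open import Data.Empty using (⊥-elim)
open import Relation.Nullary using (¬_; Dec; yes; no; contradiction)
open import Relation.Nullary.Decidable using (_⊎-dec_)
open import Relation.Unary using (Pred; Decidable)
open import Relation.Binary.PropositionalEquality hiding ([_])
open import Algebra.Properties.CommutativeSemigroup +-commutativeSemigroup using (interchange)
open import Level using (0ℓ)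

¬2∣2t+1 : ∀ t → ¬ 2 ∣ 2 * t + 1
¬2∣2t+1 t 2∣2t+1 with () ← ∣1⇒≡1 (∣m+n∣m⇒∣n 2∣2t+1 (m∣m*n t))

¬2∣2t+5 : ∀ t → ¬ 2 ∣ 2 * t + 5
¬2∣2t+5 t = subst (λ o → ¬ 2 ∣ o) (shift t) (¬2∣2t+1 (t + 2))
  where
  shift : ∀ t → 2 * (t + 2) + 1 ≡ 2 * t + 5
  shift = solve-∀

odd⇒coprime-2 : ∀ {n} → ¬ 2 ∣ n → Coprime n 2
odd⇒coprime-2 {n} ¬2∣n {d} (d∣n , d∣2) with d
... | 0                 with () ← 0∣⇒≡0 d∣2
... | 1                 = refl
... | 2                 = contradiction d∣n ¬2∣n
... | suc (suc (suc _)) with s≤s (s≤s ()) ← ∣⇒≤ d∣2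

odd⇒coprime-+4 : ∀ {n} → ¬ 2 ∣ n → Coprime n (n + 4)
odd⇒coprime-+4 ¬2∣n {d} (d∣n , d∣n+4) =
  ∣1⇒≡1 (coprime-divisor d⊥2 (coprime-divisor d⊥2 (∣m+n∣m⇒∣n d∣n+4 d∣n)))
  where
  d⊥2 : Coprime d 2
  d⊥2 = odd⇒coprime-2 (λ 2∣d → ¬2∣n (∣-trans 2∣d d∣n))

coprime-square : ∀ {m n} → Coprime m n → Coprime (m * m) n
coprime-square {m} {n} m⊥n {d} (d∣mm , d∣n) = m⊥n (d∣m , d∣n)
  where
  d∣m : d ∣ m
  d∣m = coprime-factors (coprime-sym m⊥n) (∣-trans d∣n (m∣m*n m) , d∣mm)

odd-square : ∀ {n} → ¬ 2 ∣ n → ¬ 2 ∣ n * n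
odd-square ¬2∣n 2∣nn with () ← coprime-square (odd⇒coprime-2 ¬2∣n) (2∣nn , ∣-refl)

squareFree-* : ∀ {a b} → Coprime a b → SquareFree a → SquareFree b → SquareFree (a * b)
squareFree-* {a} {b} a⊥b sf-a sf-b q qq∣ab = sf-b q (coprime-divisor (coprime-square q⊥a) qq∣ab)
  where
  g : ℕ
  g = gcd q a
  gg∣a : g * g ∣ a
  gg∣a = coprime-divisor (coprime-square g⊥b) (subst (g * g ∣_) (*-comm a b) gg∣ab)
    where
    g⊥b : Coprime g b
    g⊥b (d∣g , d∣b) = a⊥b (∣-trans d∣g (gcd[m,n]∣n q a) , d∣b)
    gg∣ab : g * g ∣ a * b
    gg∣ab = ∣-trans (*-pres-∣ (gcd[m,n]∣m q a) (gcd[m,n]∣m q a)) qq∣ab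
  q⊥a : Coprime q a
  q⊥a = gcd≡1⇒coprime (sf-a g gg∣a)

even⊎odd : ∀ n → ∃[ k ] (n ≡ 2 * k ⊎ n ≡ 2 * k + 1)
even⊎odd zero = 0 , inj₁ refl
even⊎odd (suc n) with even⊎odd n
... | k , inj₁ refl = k , inj₂ (+-comm 1 (2 * k))
... | k , inj₂ refl = suc k , inj₁ (sym (double-suc k))
  where
  double-suc : ∀ k → 2 * suc k ≡ suc (2 * k + 1)
  double-suc = solve-∀

squareFree-odd : ∀ S {o} → ¬ 2 ∣ o → o < (2 * suc S + 1) * (2 * suc S + 1) →
                 (∀ {s} → s < S → ¬ (2 * suc s + 1) * (2 * suc s + 1) ∣ o) → SquareFree o
squareFree-odd S {zero}  ¬2∣o _ _ _ _ = contradiction (2 ∣0) ¬2∣o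
squareFree-odd S {suc _} ¬2∣o o<bound sieved q qq∣o with even⊎odd q
... | k     , inj₁ refl = contradiction (∣-trans (∣-trans (m∣m*n k) (m∣m*n (2 * k))) qq∣o) ¬2∣o
... | zero  , inj₂ refl = refl
... | suc s , inj₂ refl with s <? S
...   | yes s<S = contradiction qq∣o (sieved s<S)
...   | no  s≮S = contradiction (≤-trans (*-mono-≤ bound≤q bound≤q) (∣⇒≤ qq∣o)) (<⇒≱ o<bound)
  where
  bound≤q : 2 * suc S + 1 ≤ 2 * suc s + 1
  bound≤q = +-monoˡ-≤ 1 (*-monoʳ-≤ 2 (s≤s (≮⇒≥ s≮S)))

odd-divisor-gap : ∀ {d} a → ¬ 2 ∣ d →
                  ∀ {t u} → d ∣ 2 * t + a → d ∣ 2 * u + a → t < u → t + d ≤ u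
odd-divisor-gap {d} a ¬2∣d {t} d∣t d∣u t<u with k , refl ← m≤n⇒∃[o]m+o≡n t<u = begin
  t + d       ≤⟨ +-monoʳ-≤ t (∣⇒≤ d∣gap) ⟩
  t + suc k   ≡⟨ +-suc t k ⟩
  suc t + k   ∎
  where
  open ≤-Reasoning
  shift : ∀ t k a → 2 * (suc t + k) + a ≡ (2 * t + a) + 2 * suc k
  shift = solve-∀
  d∣gap : d ∣ suc k
  d∣gap = coprime-divisor (odd⇒coprime-2 ¬2∣d) (∣m+n∣m⇒∣n (subst (d ∣_) (shift t k a) d∣u) d∣t)

indicator : ∀ {A : Set} → Dec A → ℕ
indicator (yes _) = 1
indicator (no _)  = 0

count : ∀ {P : Pred ℕ 0ℓ} → Decidable P → ℕ → ℕ
count P? zero    = 0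
count P? (suc L) = count P? L + indicator (P? L)

module _ {P : Pred ℕ 0ℓ} (P? : Decidable P) where

  count≡0 : (∀ {i} → ¬ P i) → ∀ L → count P? L ≡ 0
  count≡0 ¬P zero = refl
  count≡0 ¬P (suc L) with P? L
  ... | yes p = contradiction p ¬P
  ... | no  _ = trans (+-identityʳ _) (count≡0 ¬P L)

  count<⇒∃¬ : ∀ L → count P? L < L → ∃[ i ] (i < L × ¬ P i)
  count<⇒∃¬ (suc L) count< with P? L
  ... | no  ¬PL = L , ≤-refl , ¬PL
  ... | yes _   with i , i<L , ¬Pi ← count<⇒∃¬ L (≤-pred (subst (_< suc L) (+-comm _ 1) count<)) =
    i , m<n⇒m<1+n i<L , ¬Pi

  module _ {d : ℕ} (gap : ∀ {i j} → P i → P j → i < j → i + d ≤ j) where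

    private
      lastHit : ∀ L → count P? L ≡ 0 ⊎ ∃[ h ] (h < L × P h × (count P? L ∸ 1) * d ≤ h)
      lastHit zero = inj₁ refl
      lastHit (suc L) with P? L | lastHit L
      ... | no  _  | inj₁ c≡0 = inj₁ (trans (+-identityʳ _) c≡0)
      ... | no  _  | inj₂ (h , h<L , Ph , bound) =
        inj₂ (h , m<n⇒m<1+n h<L , Ph ,
              subst (λ c → (c ∸ 1) * d ≤ h) (sym (+-identityʳ (count P? L))) bound)
      ... | yes PL | inj₁ c≡0 =
        inj₂ (L , ≤-refl , PL , subst (λ c → (c ∸ 1) * d ≤ L) (sym (cong (_+ 1) c≡0)) z≤n)
      ... | yes PL | inj₂ (h , h<L , Ph , bound) = inj₂ (L , ≤-refl , PL , (begin
        (c + 1 ∸ 1) * d   ≡⟨ cong (_* d) (m+n∸n≡m c 1) ⟩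
        c * d             ≤⟨ *-monoˡ-≤ d (m≤n+m∸n c 1) ⟩
        d + (c ∸ 1) * d   ≤⟨ +-monoʳ-≤ d bound ⟩
        d + h             ≡⟨ +-comm d h ⟩
        h + d             ≤⟨ gap Ph PL h<L ⟩
        L                 ∎))
        where
        open ≤-Reasoning
        c : ℕ
        c = count P? L

    count-sparse : ∀ L → (count P? L ∸ 1) * d ≤ L
    count-sparse L with lastHit L
    ... | inj₁ c≡0                   = subst (λ c → (c ∸ 1) * d ≤ L) (sym c≡0) z≤n
    ... | inj₂ (h , h<L , _ , bound) = ≤-trans bound (<⇒≤ h<L)

count-⊎ : ∀ {P Q R : Pred ℕ 0ℓ} (P? : Decidable P) (Q? : Decidable Q) (R? : Decidable R) →
          (∀ {i} → P i → Q i ⊎ R i) → ∀ L → count P? L ≤ count Q? L + count R? L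
count-⊎ P? Q? R? split zero = z≤n
count-⊎ {P} {Q} {R} P? Q? R? split (suc L) = begin
  count P? L + indicator (P? L)
    ≤⟨ +-mono-≤ (count-⊎ P? Q? R? split L) (pointwise (P? L) (Q? L) (R? L)) ⟩
  (count Q? L + count R? L) + (indicator (Q? L) + indicator (R? L))
    ≡⟨ interchange (count Q? L) (count R? L) (indicator (Q? L)) (indicator (R? L)) ⟩
  (count Q? L + indicator (Q? L)) + (count R? L + indicator (R? L))
    ∎
  where
  open ≤-Reasoning
  pointwise : ∀ {i} (p : Dec (P i)) (q : Dec (Q i)) (r : Dec (R i)) →
              indicator p ≤ indicator q + indicator r
  pointwise (no _)  _       _       = z≤n
  pointwise (yes _) (yes _) _       = s≤s z≤n
  pointwise (yes _) (no _)  (yes _) = ≤-refl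
  pointwise (yes p) (no ¬q) (no ¬r) = ⊥-elim ([ ¬q , ¬r ] (split p))

AnyBelow : (ℕ → Pred ℕ 0ℓ) → ℕ → Pred ℕ 0ℓ
AnyBelow Q S i = ∃[ s ] (s < S × Q s i)

module _ {Q : ℕ → Pred ℕ 0ℓ} (Q? : ∀ s → Decidable (Q s)) where

  anyBelow? : ∀ S → Decidable (AnyBelow Q S)
  anyBelow? S i = anyUpTo? (λ s → Q? s i) S

  count-anyBelow-telescope : ∀ (F : ℕ → ℕ) k L → (∀ s → count (Q? s) L + F (suc s) ≤ F s + k) →
                             ∀ S → count (anyBelow? S) L + F S ≤ F 0 + S * k
  count-anyBelow-telescope F k L step zero = ≤-reflexive (begin-equality
    count (anyBelow? 0) L + F 0 ≡⟨ cong (_+ F 0) (count≡0 (anyBelow? 0) (λ { (_ , () , _) }) L) ⟩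
    F 0                         ≡⟨ +-identityʳ (F 0) ⟨
    F 0 + 0                     ∎)
    where open ≤-Reasoning
  count-anyBelow-telescope F k L step (suc S) = begin
    count (anyBelow? (suc S)) L + F (suc S)
      ≤⟨ +-monoˡ-≤ (F (suc S)) (count-⊎ (anyBelow? (suc S)) (anyBelow? S) (Q? S) split L) ⟩
    (below + count (Q? S) L) + F (suc S) ≡⟨ +-assoc below _ _ ⟩
    below + (count (Q? S) L + F (suc S)) ≤⟨ +-monoʳ-≤ below (step S) ⟩
    below + (F S + k)                    ≡⟨ +-assoc below (F S) k ⟨
    (below + F S) + k                    ≤⟨ +-monoˡ-≤ k (count-anyBelow-telescope F k L step S) ⟩
    (F 0 + S * k) + k                    ≡⟨ +-assoc (F 0) (S * k) k ⟩
    F 0 + (S * k + k)                    ≡⟨ cong (F 0 +_) (+-comm (S * k) k) ⟩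
    F 0 + suc S * k                      ∎
    where
    open ≤-Reasoning
    below : ℕ
    below = count (anyBelow? S) L
    split : ∀ {i} → AnyBelow Q (suc S) i → AnyBelow Q S i ⊎ Q S i
    split (s , s<1+S , q) with m<1+n⇒m<n∨m≡n s<1+S
    ... | inj₁ s<S  = inj₁ (s , s<S , q)
    ... | inj₂ refl = inj₂ q

-- 1/(2s+3)² < 1/(4(s+1)) − 1/(4(s+2)), up to the floors.
telescope-step : ∀ s {c L} → (c ∸ 1) * ((2 * suc s + 1) * (2 * suc s + 1)) ≤ L →
                 c + L / (4 * suc (suc s)) ≤ L / (4 * suc s) + 1
telescope-step s {c} {L} sparse = begin
  c + b               ≤⟨ +-monoˡ-≤ b (m≤n+m∸n c 1) ⟩
  suc (a + b)         ≤⟨ s≤s (subst (_≤ L / P) (m*n/n≡m (a + b) P) (/-monoˡ-≤ P [a+b]P≤L)) ⟩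
  suc (L / P)         ≡⟨ +-comm 1 (L / P) ⟩
  L / P + 1           ∎
  where
  open ≤-Reasoning
  P Q d a b : ℕ
  P = 4 * suc s
  Q = 4 * suc (suc s)
  d = (2 * suc s + 1) * (2 * suc s + 1)
  a = c ∸ 1
  b = L / Q
  [a+b]P≤L : (a + b) * P ≤ L
  [a+b]P≤L = *-cancelʳ-≤ ((a + b) * P) L (d * Q) (begin
    (a + b) * P * (d * Q)                 ≡⟨ regroup a b P Q d ⟩
    (a * d) * (P * Q) + (b * Q) * (P * d)
      ≤⟨ +-mono-≤ (*-monoˡ-≤ (P * Q) sparse) (*-monoˡ-≤ (P * d) (m/n*n≤m L Q)) ⟩
    L * (P * Q) + L * (P * d)             ≡⟨ *-distribˡ-+ L (P * Q) (P * d) ⟨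
    L * (P * Q + P * d)                   ≤⟨ *-monoʳ-≤ L (m≤m+n (P * Q + P * d) 4) ⟩
    L * (P * Q + P * d + 4)               ≡⟨ cong (L *_) (gap s) ⟩
    L * (d * Q)                           ∎)
    where
    regroup : ∀ a b P Q d → (a + b) * P * (d * Q) ≡ (a * d) * (P * Q) + (b * Q) * (P * d)
    regroup = solve-∀
    gap : ∀ s → 4 * suc s * (4 * suc (suc s)) + 4 * suc s * ((2 * suc s + 1) * (2 * suc s + 1)) + 4 ≡
                (2 * suc s + 1) * (2 * suc s + 1) * (4 * suc (suc s))
    gap = solve-∀

-- S is N + 1 rather than suc N so that L is not headed by suc: otherwise Agda unfolds count along L.
module PairSieve (N : ℕ) where

  S L : ℕ
  S = N + 1
  L = (S + 1) * 4

  d : ℕ → ℕ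
  d s = (2 * suc s + 1) * (2 * suc s + 1)

  Hit : ℕ → Pred ℕ 0ℓ
  Hit s i = d s ∣ 2 * (N + i) + 1 ⊎ d s ∣ 2 * (N + i) + 5

  Hit? : ∀ s → Decidable (Hit s)
  Hit? s i = (d s ∣? 2 * (N + i) + 1) ⊎-dec (d s ∣? 2 * (N + i) + 5)

  gap : ∀ s a {i j} → d s ∣ 2 * (N + i) + a → d s ∣ 2 * (N + j) + a → i < j → i + d s ≤ j
  gap s a {i} {j} d∣i d∣j i<j = +-cancelˡ-≤ N (i + d s) j (subst (_≤ N + j) (+-assoc N i (d s))
    (odd-divisor-gap a (odd-square (¬2∣2t+1 (suc s))) d∣i d∣j (+-monoʳ-< N i<j)))

  A F : ℕ → ℕ
  A s = L / (4 * suc s)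
  F s = A s + A s

  count-Hit : ∀ s → count (Hit? s) L + F (suc s) ≤ F s + 2
  count-Hit s = begin
    count (Hit? s) L + (A (suc s) + A (suc s))
      ≤⟨ +-monoˡ-≤ _ (count-⊎ (Hit? s) (hits 1) (hits 5) (λ h → h) L) ⟩
    (count (hits 1) L + count (hits 5) L) + (A (suc s) + A (suc s))
      ≡⟨ interchange (count (hits 1) L) _ _ _ ⟩
    (count (hits 1) L + A (suc s)) + (count (hits 5) L + A (suc s))
      ≤⟨ +-mono-≤ (step 1) (step 5) ⟩
    (A s + 1) + (A s + 1)
      ≡⟨ interchange (A s) 1 (A s) 1 ⟩
    (A s + A s) + 2
      ∎
    where
    open ≤-Reasoning
    hits : ∀ a → Decidable (λ i → d s ∣ 2 * (N + i) + a)
    hits a i = d s ∣? 2 * (N + i) + a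
    step : ∀ a → count (hits a) L + A (suc s) ≤ A s + 1
    step a = telescope-step s {count (hits a) L} (count-sparse (hits a) (gap s a) L)

  count<L : count (anyBelow? Hit? S) L < L
  count<L = begin-strict
    count (anyBelow? Hit? S) L               ≤⟨ m≤m+n _ (F S) ⟩
    count (anyBelow? Hit? S) L + F S         ≤⟨ count-anyBelow-telescope Hit? F 2 L count-Hit S ⟩
    F 0 + S * 2                              ≡⟨ cong (λ a → a + a + S * 2) (m*n/n≡m (S + 1) 4) ⟩
    (S + 1) + (S + 1) + S * 2                <⟨ n<1+n _ ⟩
    suc ((S + 1) + (S + 1) + S * 2)          <⟨ n<1+n _ ⟩
    suc (suc ((S + 1) + (S + 1) + S * 2))    ≡⟨ quadruple S ⟨
    L                                        ∎
    where
    open ≤-Reasoning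
    quadruple : ∀ S → (S + 1) * 4 ≡ suc (suc ((S + 1) + (S + 1) + S * 2))
    quadruple = solve-∀

  in-range : ∀ {i} → i < L → 2 * (N + i) + 5 < (2 * suc S + 1) * (2 * suc S + 1)
  in-range {i} i<L = begin-strict
    2 * (N + i) + 5
      ≤⟨ +-monoˡ-≤ 5 (*-monoʳ-≤ 2 (+-monoʳ-≤ N (<⇒≤ i<L))) ⟩
    2 * (N + L) + 5                                  <⟨ s≤s (m≤m+n _ _) ⟩
    suc (2 * (N + L) + 5) + (4 * N * N + 10 * N + 3) ≡⟨ square N ⟨
    (2 * suc S + 1) * (2 * suc S + 1)                ∎
    where
    open ≤-Reasoning
    square : ∀ N → (2 * suc (N + 1) + 1) * (2 * suc (N + 1) + 1) ≡
                   suc (2 * (N + (N + 1 + 1) * 4) + 5) + (4 * N * N + 10 * N + 3)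
    square = solve-∀

  unsieved⇒squareFree : ∀ {i} → i < L → ¬ AnyBelow Hit S i →
                        SquareFree (2 * (N + i) + 1) × SquareFree (2 * (N + i) + 5)
  unsieved⇒squareFree {i} i<L unsieved =
    squareFree-odd S (¬2∣2t+1 (N + i)) (≤-<-trans (+-monoʳ-≤ (2 * (N + i)) (s≤s z≤n)) (in-range i<L))
      (λ {s} s<S d∣ → unsieved (s , s<S , inj₁ d∣)) ,
    squareFree-odd S (¬2∣2t+5 (N + i)) (in-range i<L) (λ {s} s<S d∣ → unsieved (s , s<S , inj₂ d∣))

  squareFree-pair : ∃[ t ] (N ≤ t × SquareFree (2 * t + 1) × SquareFree (2 * t + 5))
  squareFree-pair = from-unsieved (count<⇒∃¬ (anyBelow? Hit? S) L count<L)
    where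
    from-unsieved : ∃[ i ] (i < L × ¬ AnyBelow Hit S i) →
                    ∃[ t ] (N ≤ t × SquareFree (2 * t + 1) × SquareFree (2 * t + 5))
    from-unsieved (i , i<L , unsieved) = N + i , m≤m+n N i , unsieved⇒squareFree i<L unsieved

squareFree-pair-above : ∀ N → ∃[ t ] (N ≤ t × SquareFree (2 * t + 1) × SquareFree (2 * t + 5))
squareFree-pair-above = PairSieve.squareFree-pair

WR⇒nonzero : ∀ {D I} → WR D I → ∃[ x ] (I x × x ≢ zeroOK)
WR⇒nonzero (x , _ , (Ix , x≢0 , _) , _) = x , Ix , x≢0

module Discriminant (u : ℕ) where
  open TraceIdeal.OddModulus (suc u) public

  m D : ℕ
  m = 2 * suc u + 5
  D = n * m

  D%4≡1 : D % 4 ≡ 1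
  D%4≡1 = trans (cong (_% 4) (expand u)) ([m+kn]%n≡m%n 1 (suc u * suc u + 3 * suc u + 1) 4)
    where
    expand : ∀ u → (2 * suc u + 1) * (2 * suc u + 5) ≡ 1 + (suc u * suc u + 3 * suc u + 1) * 4
    expand = solve-∀

  n²≤3D : n * n ≤ 3 * D
  n²≤3D = ≤-trans (*-monoʳ-≤ n (+-monoʳ-≤ (2 * suc u) (s≤s z≤n))) (m≤n*m D 3)

  D≤3n² : D ≤ 3 * (n * n)
  D≤3n² = subst (D ≤_) (sym (expand u)) (m≤m+n D _)
    where
    expand : ∀ u → 3 * ((2 * suc u + 1) * (2 * suc u + 1)) ≡
                   (2 * suc u + 1) * (2 * suc u + 5) + (2 * suc u + 1) * (4 * u + 2)
    expand = solve-∀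

  n⊥m : Coprime n m
  n⊥m = subst (Coprime n) (+-assoc (2 * suc u) 1 4) (odd⇒coprime-+4 (¬2∣2t+1 (suc u)))

  1+u<D : suc u < D
  1+u<D = <-≤-trans (≤-<-trans (m≤n*m (suc u) 2) (m<m+n (2 * suc u) z<s)) (m≤m*n n m)

lemma2p7 : ∀ (N : ℕ) → ∃[ D ] (N < D × 1 < D × SquareFree D × D % 4 ≡ 1 ×
             ∃[ I ] (NonzeroIdeal D I × WR D I))
lemma2p7 N = from-pair (squareFree-pair-above (suc N))
  where
  from-pair : ∃[ t ] (suc N ≤ t × SquareFree (2 * t + 1) × SquareFree (2 * t + 5)) →
              ∃[ D ] (N < D × 1 < D × SquareFree D × D % 4 ≡ 1 × ∃[ I ] (NonzeroIdeal D I × WR D I))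
  from-pair (suc u , s≤s N≤u , sf-n , sf-m) =
    D , <-trans (s≤s N≤u) 1+u<D , ≤-trans (s≤s (s≤s z≤n)) 1+u<D , squareFree-* n⊥m sf-n sf-m ,
    D%4≡1 , I , (isIdeal {D} D%4≡1 (m∣m*n m) , WR⇒nonzero {D} wr) , wr
    where
    open Discriminant u
    wr : WR D I
    wr = wellRounded {D} n²≤3D D≤3n²
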